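{- Let $a\ge 1$ and $b$ be integers. Then the set $\{\,s(n)-n : n=aj+b \text{ for some integer } j\ge 0,\ n\ge 0\,\}$ is unbounded.
   Context: For integers $m\ge 0$, $k\ge0$ let $\operatorname{bit}_k(m)=\lfloor m/2^k\rfloor\bmod 2$. For $n\ge 0$ the sloping binary number is $s(n)=\sum_{k\ge 0}\operatorname{bit}_k(n+k)2^k$ (the $2^k$ digit of $s(n)$ is the $2^k$ digit of $n+k$). -}

module Defs where

open import Data.Nat using (ℕ; zero; suc; _+_; _*_; _^_)
open import Data.Nat.DivMod using (_/_; _%_)
open import Data.Nat.Properties using (m^n≢0)

bit : ℕ → ℕ → ℕ
bit k m = ((m / (2 ^ k)) {{m^n≢0 2 k}}) % 2

slopeSum : ℕ → ℕ → ℕ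
slopeSum zero    n = 0
slopeSum (suc N) n = slopeSum N n + bit N (n + N) * 2 ^ N

-- s(n) = Σ_{k ≥ 0} bit_k(n+k) 2^k.  All terms with k > n vanish,
-- since n + k < 2^k for k ≥ n + 1, so the sum over k < n + 1 is the full sum.
s : ℕ → ℕ
s n = slopeSum (suc n) n

{-# OPTIONS --safe #-}
module Submission where

-- Take n = 2^k ∸ c with c ≤ k. Then n + k = 2^k + (k ∸ c) with k ∸ c < 2^k, so the 2^k digit of
-- n + k is 1 and the sloping number picks up the summand 2^k = n + c: thus s(n) - n ≥ c. Modulo a,
-- c can be chosen in any window of a consecutive values, so one gets n ≡ b (mod a) and c > M.

open import Defs
open import Data.Product using (Σ; _×_; _,_; ∃₂)
open import Relation.Binary.PropositionalEquality
  using (_≡_; refl; sym; trans; cong; cong₂; subst; module ≡-Reasoning)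

module SlopingGap where

  open import Data.Nat
    using (ℕ; zero; suc; _+_; _*_; _∸_; _^_; _≤_; _<_; z≤n; s≤s; NonZero; >-nonZero⁻¹)
  open import Data.Nat.Properties
  open import Data.Nat.DivMod
    using (_/_; _%_; m≡m%n+[m/n]*n; m%n<n; n/n≡1; m<n⇒m/n≡0; +-distrib-/-∣ˡ)
  open import Data.Nat.Divisibility using (∣-refl)
  open import Data.Nat.Tactic.RingSolver using (solve-∀)
  open import Data.Sum using (inj₁; inj₂)

  n<2^n : ∀ n → n < 2 ^ n
  n<2^n zero    = s≤s z≤n
  n<2^n (suc n) = begin-strict
    1 + n             <⟨ +-mono-≤-< (m^n>0 2 n) (n<2^n n) ⟩
    2 ^ n + 2 ^ n     ≡⟨ cong (2 ^ n +_) (sym (+-identityʳ (2 ^ n))) ⟩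
    2 ^ suc n         ∎
    where open ≤-Reasoning

  n≤2^n : ∀ n → n ≤ 2 ^ n
  n≤2^n n = <⇒≤ (n<2^n n)

  n+n≤2^n : ∀ n → n + n ≤ 2 ^ n
  n+n≤2^n zero    = z≤n
  n+n≤2^n (suc n) = begin
    suc n + suc n     ≤⟨ +-mono-≤ (n<2^n n) (n<2^n n) ⟩
    2 ^ n + 2 ^ n     ≡⟨ cong (2 ^ n +_) (sym (+-identityʳ (2 ^ n))) ⟩
    2 ^ suc n         ∎
    where open ≤-Reasoning

  bit-2^k+r : ∀ k {r} → r < 2 ^ k → bit k (2 ^ k + r) ≡ 1
  bit-2^k+r k {r} r<2^k = cong (_% 2) (begin
    (2 ^ k + r) / 2 ^ k        ≡⟨ +-distrib-/-∣ˡ r ∣-refl ⟩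
    2 ^ k / 2 ^ k + r / 2 ^ k  ≡⟨ cong₂ _+_ (n/n≡1 (2 ^ k)) (m<n⇒m/n≡0 r<2^k) ⟩
    1                          ∎)
    where
    open ≡-Reasoning
    instance
      2^k≢0 : NonZero (2 ^ k)
      2^k≢0 = m^n≢0 2 k

  bit*2^k≤slopeSum : ∀ {k N} n → k < N → bit k (n + k) * 2 ^ k ≤ slopeSum N n
  bit*2^k≤slopeSum {k} {suc N} n (s≤s k≤N) with m≤n⇒m<n∨m≡n k≤N
  ... | inj₁ k<N  = ≤-trans (bit*2^k≤slopeSum n k<N) (m≤m+n _ _)
  ... | inj₂ refl = m≤n+m _ _

  bit≡1⇒2^k≤s : ∀ {k n} → k ≤ n → bit k (n + k) ≡ 1 → 2 ^ k ≤ s n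
  bit≡1⇒2^k≤s {k} {n} k≤n bit≡1 = begin
    2 ^ k                  ≡⟨ sym (*-identityˡ (2 ^ k)) ⟩
    1 * 2 ^ k              ≡⟨ cong (_* 2 ^ k) bit≡1 ⟨
    bit k (n + k) * 2 ^ k  ≤⟨ bit*2^k≤slopeSum n (s≤s k≤n) ⟩
    s n                    ∎
    where open ≤-Reasoning

  2^k≤s[2^k∸c] : ∀ {k c} → c ≤ k → 2 ^ k ≤ s (2 ^ k ∸ c)
  2^k≤s[2^k∸c] {k} {c} c≤k =
    bit≡1⇒2^k≤s k≤2^k∸c (trans (cong (bit k) n+k≡2^k+[k∸c]) (bit-2^k+r k k∸c<2^k))
    where
    c≤2^k : c ≤ 2 ^ k
    c≤2^k = ≤-trans c≤k (n≤2^n k)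
    k≤2^k∸c : k ≤ 2 ^ k ∸ c
    k≤2^k∸c = m+n≤o⇒m≤o∸n k (≤-trans (+-monoʳ-≤ k c≤k) (n+n≤2^n k))
    k∸c<2^k : k ∸ c < 2 ^ k
    k∸c<2^k = ≤-<-trans (m∸n≤m k c) (n<2^n k)
    n+k≡2^k+[k∸c] : 2 ^ k ∸ c + k ≡ 2 ^ k + (k ∸ c)
    n+k≡2^k+[k∸c] = begin
      2 ^ k ∸ c + k    ≡⟨ +-comm (2 ^ k ∸ c) k ⟩
      k + (2 ^ k ∸ c)  ≡⟨ +-∸-assoc k c≤2^k ⟨
      k + 2 ^ k ∸ c    ≡⟨ cong (_∸ c) (+-comm k (2 ^ k)) ⟩
      2 ^ k + k ∸ c    ≡⟨ +-∸-assoc (2 ^ k) c≤k ⟩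
      2 ^ k + (k ∸ c)  ∎
      where open ≡-Reasoning

  c≤s[2^k∸c]∸[2^k∸c] : ∀ {k c} → c ≤ k → c ≤ s (2 ^ k ∸ c) ∸ (2 ^ k ∸ c)
  c≤s[2^k∸c]∸[2^k∸c] {k} {c} c≤k = begin
    c                            ≡⟨ m∸[m∸n]≡n (≤-trans c≤k (n≤2^n k)) ⟨
    2 ^ k ∸ (2 ^ k ∸ c)          ≤⟨ ∸-monoˡ-≤ (2 ^ k ∸ c) (2^k≤s[2^k∸c] c≤k) ⟩
    s (2 ^ k ∸ c) ∸ (2 ^ k ∸ c)  ∎
    where open ≤-Reasoning

  x≡a*j+P+c-with-M<c≤M+a : ∀ a ⦃ _ : NonZero a ⦄ M P {x} → M + P < x →
                           ∃₂ λ j c → M < c × c ≤ M + a × x ≡ a * j + P + c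
  x≡a*j+P+c-with-M<c≤M+a a M P {x} M+P<x = j , suc (M + ρ) , s≤s (m≤m+n M ρ) , c≤M+a , x≡
    where
    y = x ∸ suc (M + P)
    ρ = y % a
    j = y / a
    c≤M+a : suc (M + ρ) ≤ M + a
    c≤M+a = begin
      suc (M + ρ)  ≡⟨ +-suc M ρ ⟨
      M + suc ρ    ≤⟨ +-monoʳ-≤ M (m%n<n y a) ⟩
      M + a        ∎
      where open ≤-Reasoning
    x≡ : x ≡ a * j + P + suc (M + ρ)
    x≡ = begin
      x                          ≡⟨ m∸n+n≡m M+P<x ⟨
      y + suc (M + P)            ≡⟨ cong (_+ suc (M + P)) (m≡m%n+[m/n]*n y a) ⟩
      ρ + j * a + suc (M + P)    ≡⟨ rearrange ρ j a P M ⟩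
      a * j + P + suc (M + ρ)    ∎
      where
      open ≡-Reasoning
      rearrange : ∀ ρ j a P M → ρ + j * a + suc (M + P) ≡ a * j + P + suc (M + ρ)
      rearrange = solve-∀

  sloping-gap-unbounded-mod : ∀ a ⦃ _ : NonZero a ⦄ P N M →
                              ∃₂ λ j n → n + N ≡ a * j + P × M < s n ∸ n × n ≤ s n
  sloping-gap-unbounded-mod a P N M = gap (x≡a*j+P+c-with-M<c≤M+a a M P M+P<2^k+N)
    where
    k = M + a + P
    M+P<2^k+N : M + P < 2 ^ k + N
    M+P<2^k+N = begin-strict
      M + P      <⟨ +-monoˡ-< P (m<m+n M (>-nonZero⁻¹ a)) ⟩
      k          <⟨ n<2^n k ⟩
      2 ^ k      ≤⟨ m≤m+n (2 ^ k) N ⟩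
      2 ^ k + N  ∎
      where open ≤-Reasoning
    gap : (∃₂ λ j c → M < c × c ≤ M + a × 2 ^ k + N ≡ a * j + P + c) →
          ∃₂ λ j n → n + N ≡ a * j + P × M < s n ∸ n × n ≤ s n
    gap (j , c , M<c , c≤M+a , 2^k+N≡) =
      j , 2 ^ k ∸ c , n+N≡ , ≤-trans M<c (c≤s[2^k∸c]∸[2^k∸c] c≤k) ,
      ≤-trans (m∸n≤m (2 ^ k) c) (2^k≤s[2^k∸c] c≤k)
      where
      c≤k : c ≤ k
      c≤k = ≤-trans c≤M+a (m≤m+n (M + a) P)
      n+N≡ : 2 ^ k ∸ c + N ≡ a * j + P
      n+N≡ = begin
        2 ^ k ∸ c + N      ≡⟨ +-∸-comm N (≤-trans c≤k (n≤2^n k)) ⟨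
        2 ^ k + N ∸ c      ≡⟨ cong (_∸ c) 2^k+N≡ ⟩
        a * j + P + c ∸ c  ≡⟨ m+n∸n≡m (a * j + P) c ⟩
        a * j + P          ∎
        where open ≡-Reasoning

open SlopingGap using (sloping-gap-unbounded-mod)

import Data.Nat as ℕ
open import Data.Nat using (ℕ; _≥_; _<_; >-nonZero)
open import Data.Integer using (ℤ; +_; _+_; _*_; _-_; ∣_∣; -[1+_])
open import Data.Integer.Properties using (+-identityʳ; pos-+; pos-*; m-n≡m⊖n; ⊖-≥)
open import Data.Integer.Tactic.RingSolver using (solve-∀)

i≡+m-+n : ∀ i → ∃₂ λ m n → i ≡ + m - + n
i≡+m-+n (+ m)    = m , 0 , sym (+-identityʳ (+ m))
i≡+m-+n -[1+ n ] = 0 , ℕ.suc n , refl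

+m≡+q+[+p-+n] : ∀ {m n p q} → m ℕ.+ n ≡ q ℕ.+ p → + m ≡ + q + (+ p - + n)
+m≡+q+[+p-+n] {m} {n} {p} {q} m+n≡q+p = begin
  + m                  ≡⟨ cancel (+ m) (+ n) ⟩
  + m + + n - + n      ≡⟨ cong (_- + n) (pos-+ m n) ⟨
  + (m ℕ.+ n) - + n    ≡⟨ cong (λ x → + x - + n) m+n≡q+p ⟩
  + (q ℕ.+ p) - + n    ≡⟨ cong (_- + n) (pos-+ q p) ⟩
  + q + + p - + n      ≡⟨ reassociate (+ q) (+ p) (+ n) ⟩
  + q + (+ p - + n)    ∎
  where
  open ≡-Reasoning
  cancel : ∀ x y → x ≡ x + y - y
  cancel = solve-∀
  reassociate : ∀ x y z → x + y - z ≡ x + (y - z)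
  reassociate = solve-∀

∣+m-+n∣≡m∸n : ∀ {m n} → n ℕ.≤ m → ∣ + m - + n ∣ ≡ m ℕ.∸ n
∣+m-+n∣≡m∸n {m} {n} n≤m = cong ∣_∣ (trans (m-n≡m⊖n m n) (⊖-≥ n≤m))

theorem4 : (a : ℕ) → a ≥ 1 → (b : ℤ) → (M : ℕ) →
    Σ ℕ (λ j → Σ ℕ (λ n → (+ n ≡ (+ a) * (+ j) + b) × (M < ∣ (+ s n) - (+ n) ∣)))
theorem4 a a≥1 b M with P , N , refl ← i≡+m-+n b
  with j , n , n+N≡a*j+P , M<s[n]∸n , n≤s[n] ← sloping-gap-unbounded-mod a ⦃ >-nonZero a≥1 ⦄ P N M =
  j , n , trans (+m≡+q+[+p-+n] n+N≡a*j+P) (cong (_+ (+ P - + N)) (pos-* a j)) ,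
  subst (M <_) (sym (∣+m-+n∣≡m∸n n≤s[n])) M<s[n]∸n
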